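{- Let $a,b,c$ be pairwise coprime integers greater than $1$ with $a,b$ odd and $c$ even. Put $\alpha=\min\{\nu_2(a^2-1)-1,\nu_2(b^2-1)-1\}$ and $\beta=\nu_2(c)$. Let $(X,Y,Z)$ and $(X',Y',Z')$ be two solutions in positive integers of $a^x+b^y=c^z$ with $\beta Z\ne1$ and $\beta Z'\ne 1$. If $X\not\equiv X'\pmod 2$, then $Z=\alpha/\beta$ or $Z'=\alpha/\beta$.
   Context: $\nu_2(A)$ denotes the exponent of $2$ in the nonzero integer $A$. -}

module Defs where

open import Data.Nat using (ℕ; suc; _^_; _∸_; _*_)
open import Data.Nat.Divisibility using (_∣_)
open import Data.Product using (_×_)
open import Relation.Nullary using (¬_)

IsNu2 : ℕ → ℕ → Set
IsNu2 n k = (2 ^ k ∣ n) × ¬ (2 ^ suc k ∣ n)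

-- Write an odd a > 1 as ε + 2^α·(odd) with ε = ±1 ≡ a (mod 4); then α ≥ 2 and
-- ν₂(a² − 1) = α + 1, so even powers of a are ≡ 1 and odd powers ≡ ε + 2^α (mod 2^(α+1)).
-- For u, v ≡ ±1 (mod 4) the valuation ν₂(u + v) is 1 when u ≡ v (mod 4), and it equals k
-- when ν₂(u − ε) = k and v ≡ −ε (mod 2^(k+1)). As ν₂(c^Z) = βZ ≠ 1, the solution with X
-- even forces βZ = α_b when α_b ≤ α_a; otherwise b^Y′ ≡ ±1 (mod 2^(α_a+1)) and the solution
-- with X′ odd gives βZ′ = α_a.
module Submission where

open import Defs
open import Data.Nat using (ℕ; zero; suc; _^_; _+_; _*_; _∸_; _<_; _≤_; _⊓_; z≤n; s≤s; _≤?_; >-nonZero)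
open import Data.Nat.Properties
open import Data.Nat.Coprimality using (Coprime)
open import Data.Nat.Divisibility
open import Data.Nat.DivMod using (_divMod_; result)
open import Data.Nat.Induction using (<-rec)
open import Data.Nat.Primality using (euclidsLemma; prime?)
open import Data.Nat.Tactic.RingSolver using (solve-∀)
open import Data.Fin using (zero; suc)
open import Data.Product using (_×_; _,_; proj₁; ∃)
open import Data.Sum using (_⊎_; inj₁; inj₂; [_,_]′; swap)
open import Relation.Nullary using (¬_; yes; no; contradiction)
open import Relation.Nullary.Decidable using (from-yes)
open import Relation.Binary.PropositionalEquality

^-monoʳ-∣ : ∀ b {m n} → m ≤ n → b ^ m ∣ b ^ n
^-monoʳ-∣ b {m} m≤n with m≤n⇒∃[o]m+o≡n m≤n
... | o , refl = divides (b ^ o) (trans (^-distribˡ-+-* b m o) (*-comm (b ^ m) (b ^ o)))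

IsNu2-one : IsNu2 1 0
IsNu2-one = 1∣ 1 , λ 2∣1 → contradiction (∣1⇒≡1 2∣1) λ ()

IsNu2-two : IsNu2 2 1
IsNu2-two = ∣-refl , λ 4∣2 → contradiction (∣⇒≤ 4∣2) λ { (s≤s (s≤s ())) }

IsNu2⇒≤ : ∀ {n k j} → IsNu2 n k → 2 ^ j ∣ n → j ≤ k
IsNu2⇒≤ {k = k} {j} (_ , 2^1+k∤n) 2^j∣n with j ≤? k
... | yes j≤k = j≤k
... | no j≰k = contradiction (∣-trans (^-monoʳ-∣ 2 (≰⇒> j≰k)) 2^j∣n) 2^1+k∤n

IsNu2-unique : ∀ {n j k} → IsNu2 n j → IsNu2 n k → j ≡ k
IsNu2-unique νj νk = ≤-antisym (IsNu2⇒≤ νk (proj₁ νj)) (IsNu2⇒≤ νj (proj₁ νk))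

IsNu2-+ : ∀ {m n k} → IsNu2 m k → 2 ^ suc k ∣ n → IsNu2 (m + n) k
IsNu2-+ {m} {n} {k} (2^k∣m , 2^1+k∤m) 2^1+k∣n =
  ∣m∣n⇒∣m+n 2^k∣m (∣-trans (n∣m*n 2) 2^1+k∣n) ,
  λ 2^1+k∣m+n → 2^1+k∤m (∣m+n∣m⇒∣n (subst (2 ^ suc k ∣_) (+-comm m n) 2^1+k∣m+n) 2^1+k∣n)

IsNu2-+⁻¹ : ∀ {m n k} → IsNu2 m k → 2 ^ suc k ∣ m + n → IsNu2 n k
IsNu2-+⁻¹ {m} {n} {k} (2^k∣m , 2^1+k∤m) 2^1+k∣m+n =
  ∣m+n∣m⇒∣n (∣-trans (n∣m*n 2) 2^1+k∣m+n) 2^k∣m ,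
  λ 2^1+k∣n → 2^1+k∤m (∣m+n∣m⇒∣n (subst (2 ^ suc k ∣_) (+-comm m n) 2^1+k∣m+n) 2^1+k∣n)

IsNu2⇒odd-part : ∀ {n k} → IsNu2 n k → ∃ λ q → n ≡ q * 2 ^ k × ¬ 2 ∣ q
IsNu2⇒odd-part {k = k} (divides q n≡q*2^k , 2^1+k∤n) = q , n≡q*2^k , λ where
  (divides r refl) → 2^1+k∤n (divides r (trans n≡q*2^k (*-assoc r 2 (2 ^ k))))

IsNu2-* : ∀ {m n j k} → IsNu2 m j → IsNu2 n k → IsNu2 (m * n) (j + k)
IsNu2-* {m} {n} {j} {k} νm νn with IsNu2⇒odd-part {m} {j} νm | IsNu2⇒odd-part {n} {k} νn
... | q , refl , 2∤q | r , refl , 2∤r = 2^[j+k]∣mn , 2^1+j+k∤mn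
  where
  instance _ = m^n≢0 2 (j + k)
  mn≡qr*2^[j+k] : q * 2 ^ j * (r * 2 ^ k) ≡ q * r * 2 ^ (j + k)
  mn≡qr*2^[j+k] = begin
    q * 2 ^ j * (r * 2 ^ k)   ≡⟨ rearrange q r (2 ^ j) (2 ^ k) ⟩
    q * r * (2 ^ j * 2 ^ k)   ≡⟨ cong (q * r *_) (^-distribˡ-+-* 2 j k) ⟨
    q * r * 2 ^ (j + k)       ∎
    where
    open ≡-Reasoning
    rearrange : ∀ q r x y → q * x * (r * y) ≡ q * r * (x * y)
    rearrange = solve-∀
  2^[j+k]∣mn : 2 ^ (j + k) ∣ q * 2 ^ j * (r * 2 ^ k)
  2^[j+k]∣mn = subst (_∣ q * 2 ^ j * (r * 2 ^ k)) (sym (^-distribˡ-+-* 2 j k))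
                 (*-pres-∣ (proj₁ νm) (proj₁ νn))
  2^1+j+k∤mn : ¬ 2 ^ suc (j + k) ∣ q * 2 ^ j * (r * 2 ^ k)
  2^1+j+k∤mn 2^1+j+k∣mn =
    [ 2∤q , 2∤r ]′ (euclidsLemma q r (from-yes (prime? 2))
      (*-cancelʳ-∣ (2 ^ (j + k)) (subst (2 ^ suc (j + k) ∣_) mn≡qr*2^[j+k] 2^1+j+k∣mn)))

IsNu2-^ : ∀ {m k} → IsNu2 m k → ∀ n → IsNu2 (m ^ n) (k * n)
IsNu2-^ {k = k} νm zero    = subst (IsNu2 1) (sym (*-zeroʳ k)) IsNu2-one
IsNu2-^ {k = k} νm (suc n) =
  subst (IsNu2 _) (sym (*-suc k n)) (IsNu2-* {j = k} {k * n} νm (IsNu2-^ {k = k} νm n))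

IsNu2-exists : ∀ n → 0 < n → ∃ (IsNu2 n)
IsNu2-exists = <-rec _ strip
  where
  strip : ∀ n → (∀ {m} → m < n → 0 < m → ∃ (IsNu2 m)) → 0 < n → ∃ (IsNu2 n)
  strip n rec 0<n with 2 ∣? n
  ... | no 2∤n = 0 , 1∣ n , 2∤n
  ... | yes (divides (suc q) refl) with rec (m<m*n (suc q) 2 (s≤s (s≤s z≤n))) (s≤s z≤n)
  ...   | k , νq = k + 1 , IsNu2-* {j = k} {1} νq IsNu2-two

data Sign : Set where
  plus minus : Sign

opposite : Sign → Sign
opposite plus  = minus
opposite minus = plus

-- offset ε u is u − ε, reading the sign ε as ±1.
offset : Sign → ℕ → ℕ
offset plus  u = u ∸ 1
offset minus u = suc u

infix 4 _≡_[mod2^_]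
_≡_[mod2^_] : ℕ → Sign → ℕ → Set
u ≡ ε [mod2^ k ] = 2 ^ k ∣ offset ε u

offset-positive : ∀ ε {a} → 1 < a → 0 < offset ε a
offset-positive plus  (s≤s (s≤s z≤n)) = s≤s z≤n
offset-positive minus _               = s≤s z≤n

offset-+ : ∀ {u v} → 0 < u → 0 < v → ∀ ε → offset ε u + offset (opposite ε) v ≡ u + v
offset-+ {suc u} {suc v} _ _ plus  = +-suc u (suc v)
offset-+ {suc u} {suc v} _ _ minus = sym (+-suc (suc u) v)

≡[mod2^]-weaken : ∀ {u ε j k} → j ≤ k → u ≡ ε [mod2^ k ] → u ≡ ε [mod2^ j ]
≡[mod2^]-weaken j≤k = ∣-trans (^-monoʳ-∣ 2 j≤k)

≡[mod4]⇒IsNu2-opposite : ∀ {u ε} → 0 < u →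
  u ≡ ε [mod2^ 2 ] → IsNu2 (offset (opposite ε) u) 1
≡[mod4]⇒IsNu2-opposite {suc u} {plus}  _ 4∣u   = IsNu2-+ {2} {u} {1} IsNu2-two 4∣u
≡[mod4]⇒IsNu2-opposite {suc u} {minus} _ 4∣2+u = IsNu2-+⁻¹ {2} {u} {1} IsNu2-two 4∣2+u

same-sign-sum : ∀ {u v ε} → 0 < u → 0 < v →
  u ≡ ε [mod2^ 2 ] → v ≡ ε [mod2^ 2 ] → IsNu2 (u + v) 1
same-sign-sum {u} {v} {ε} 0<u 0<v u≡ε v≡ε =
  subst (λ n → IsNu2 n 1)
    (trans (+-comm (offset (opposite ε) v) (offset ε u)) (offset-+ 0<u 0<v ε))
    (IsNu2-+ {offset (opposite ε) v} {offset ε u} {1}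
      (≡[mod4]⇒IsNu2-opposite {ε = ε} 0<v v≡ε) u≡ε)

opposite-sign-sum : ∀ {u v ε k} → 0 < u → 0 < v →
  IsNu2 (offset ε u) k → v ≡ opposite ε [mod2^ suc k ] → IsNu2 (u + v) k
opposite-sign-sum {u} {v} {ε} {k} 0<u 0<v νu v≡-ε =
  subst (λ n → IsNu2 n k) (offset-+ 0<u 0<v ε)
    (IsNu2-+ {offset ε u} {offset (opposite ε) v} {k} νu v≡-ε)

sign-or-opposite : ∀ ε δ → δ ≡ ε ⊎ δ ≡ opposite ε
sign-or-opposite plus  plus  = inj₁ refl
sign-or-opposite plus  minus = inj₂ refl
sign-or-opposite minus plus  = inj₂ refl
sign-or-opposite minus minus = inj₁ refl

sum-dichotomy : ∀ {u v ε δ k} → 0 < u → 0 < v → 2 ≤ k →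
  IsNu2 (offset ε u) k → v ≡ δ [mod2^ suc k ] → IsNu2 (u + v) 1 ⊎ IsNu2 (u + v) k
sum-dichotomy {u} {v} {ε} {δ} {k} 0<u 0<v 2≤k νu v≡δ with sign-or-opposite ε δ
... | inj₁ refl = inj₁ (same-sign-sum {ε = ε} 0<u 0<v
                          (≡[mod2^]-weaken {u} {ε} 2≤k (proj₁ νu))
                          (≡[mod2^]-weaken {v} {ε} (m≤n⇒m≤1+n 2≤k) v≡δ))
... | inj₂ refl = inj₂ (opposite-sign-sum {ε = ε} {k} 0<u 0<v νu v≡δ)

odd⇒≡[mod4] : ∀ {a} → ¬ 2 ∣ a → ∃ λ ε → a ≡ ε [mod2^ 2 ]
odd⇒≡[mod4] {a} 2∤a with a divMod 4
... | result q zero                   refl = contradiction (∣n⇒∣m*n q (divides 2 refl)) 2∤a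
... | result q (suc zero)             refl = plus , n∣m*n q
... | result q (suc (suc zero))       refl =
  contradiction (∣m∣n⇒∣m+n ∣-refl (∣n⇒∣m*n q (divides 2 refl))) 2∤a
... | result q (suc (suc (suc zero))) refl = minus , n∣m*n (suc q)

odd⇒suc[*2] : ∀ {n} → ¬ 2 ∣ n → ∃ λ q → n ≡ suc (q * 2)
odd⇒suc[*2] {n} 2∤n with n divMod 2
... | result q zero       refl = contradiction (n∣m*n q) 2∤n
... | result q (suc zero) refl = q , refl

2∤m+n⇒parities-differ : ∀ {m n} → ¬ 2 ∣ m + n →
  (2 ∣ m × ¬ 2 ∣ n) ⊎ (¬ 2 ∣ m × 2 ∣ n)
2∤m+n⇒parities-differ {m} {n} 2∤m+n with 2 ∣? m | 2 ∣? n
... | yes 2∣m | yes 2∣n = contradiction (∣m∣n⇒∣m+n 2∣m 2∣n) 2∤m+n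
... | yes 2∣m | no  2∤n = inj₁ (2∣m , 2∤n)
... | no  2∤m | yes 2∣n = inj₂ (2∤m , 2∣n)
... | no  2∤m | no  2∤n with odd⇒suc[*2] 2∤m | odd⇒suc[*2] 2∤n
...   | q , refl | r , refl = contradiction (divides (suc (q + r)) (odd+odd q r)) 2∤m+n
  where
  odd+odd : ∀ q r → suc (q * 2) + suc (r * 2) ≡ suc (q + r) * 2
  odd+odd = solve-∀

offset-* : ∀ ε {a w} → 0 < a → 0 < w → offset ε (a * w) ≡ offset ε a + a * (w ∸ 1)
offset-* plus  {suc a} {suc w} _ _ = expand a w
  where
  expand : ∀ a w → w + a * suc w ≡ a + (w + a * w)
  expand = solve-∀
offset-* minus {suc a} {suc w} 0<a 0<w = cong (2 +_) (offset-* plus 0<a 0<w)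

^2∸1≡offset*offset : ∀ ε a → a ^ 2 ∸ 1 ≡ offset ε a * offset (opposite ε) a
^2∸1≡offset*offset plus  zero    = refl
^2∸1≡offset*offset minus zero    = refl
^2∸1≡offset*offset plus  (suc a) = expand a
  where
  expand : ∀ a → a * 1 + a * suc (a * 1) ≡ a * suc (suc a)
  expand = solve-∀
^2∸1≡offset*offset minus (suc a) = expand a
  where
  expand : ∀ a → a * 1 + a * suc (a * 1) ≡ suc (suc a) * a
  expand = solve-∀

^-≡1[mod2^] : ∀ {u k} → 0 < u → u ≡ plus [mod2^ k ] → ∀ n → u ^ n ≡ plus [mod2^ k ]
^-≡1[mod2^] {u} {k} 0<u u≡1 zero    = (2 ^ k) ∣0
^-≡1[mod2^] {u} {k} 0<u u≡1 (suc n) =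
  subst (2 ^ k ∣_) (sym (offset-* plus 0<u (m^n>0 u n)))
    (∣m∣n⇒∣m+n u≡1 (∣n⇒∣m*n u (^-≡1[mod2^] {u} {k} 0<u u≡1 n)))
  where instance _ = >-nonZero 0<u

record Odd2Adic (a : ℕ) : Set where
  field
    positive : 0 < a
    sign     : Sign
    depth    : ℕ
    exact    : IsNu2 (offset sign a) depth
    deep     : 2 ≤ depth
    square   : IsNu2 (a ^ 2 ∸ 1) (suc depth)

odd2Adic : ∀ {a} → 1 < a → ¬ 2 ∣ a → Odd2Adic a
odd2Adic {a} 1<a 2∤a with odd⇒≡[mod4] 2∤a
... | ε , a≡ε with IsNu2-exists (offset ε a) (offset-positive ε 1<a)
... | α , νa = record
  { positive = <⇒≤ 1<a
  ; sign     = ε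
  ; depth    = α
  ; exact    = νa
  ; deep     = IsNu2⇒≤ νa a≡ε
  ; square   = subst₂ IsNu2 (sym (^2∸1≡offset*offset ε a)) (+-comm α 1)
                 (IsNu2-* {j = α} {1} νa (≡[mod4]⇒IsNu2-opposite {ε = ε} (<⇒≤ 1<a) a≡ε))
  }

module _ {a} (A : Odd2Adic a) where
  open Odd2Adic A

  even-power : ∀ {X} → 2 ∣ X → a ^ X ≡ plus [mod2^ suc depth ]
  even-power (divides q refl) =
    subst (_≡ plus [mod2^ suc depth ]) (trans (^-*-assoc a 2 q) (cong (a ^_) (*-comm 2 q)))
      (^-≡1[mod2^] {a ^ 2} {suc depth} (m^n>0 a 2) (proj₁ square) q)
    where instance _ = >-nonZero positive

  odd-power : ∀ {X} → ¬ 2 ∣ X → IsNu2 (offset sign (a ^ X)) depth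
  odd-power 2∤X with odd⇒suc[*2] 2∤X
  ... | q , refl =
    subst (λ n → IsNu2 n depth) (sym (offset-* sign positive (m^n>0 a (q * 2))))
      (IsNu2-+ {offset sign a} {a * (a ^ (q * 2) ∸ 1)} {depth} exact
        (∣n⇒∣m*n a (even-power (divides q refl))))
    where instance _ = >-nonZero positive

  depth≡ν∸1 : ∀ {n} → IsNu2 (a ^ 2 ∸ 1) n → depth ≡ n ∸ 1
  depth≡ν∸1 {n} νa² = cong (_∸ 1) (IsNu2-unique {j = suc depth} {n} square νa²)

  power-residue : ∀ X → ∃ λ δ → a ^ X ≡ δ [mod2^ depth ]
  power-residue X with 2 ∣? X
  ... | yes 2∣X = plus , ≡[mod2^]-weaken {a ^ X} {plus} (n≤1+n depth) (even-power 2∣X)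
  ... | no  2∤X = sign , proj₁ (odd-power 2∤X)

module _ {a b} (A : Odd2Adic a) (B : Odd2Adic b) where
  open Odd2Adic

  private
    a^>0 : ∀ X → 0 < a ^ X
    a^>0 = m^n>0 a where instance _ = >-nonZero (positive A)
    b^>0 : ∀ Y → 0 < b ^ Y
    b^>0 = m^n>0 b where instance _ = >-nonZero (positive B)

    exclude-1 : ∀ {n K k} → IsNu2 n K → K ≢ 1 → IsNu2 n 1 ⊎ IsNu2 n k → K ≡ k
    exclude-1 {K = K} νK K≢1 =
      [ (λ ν1 → contradiction (IsNu2-unique {j = K} νK ν1) K≢1) , IsNu2-unique {j = K} νK ]′

  even-solution : ∀ {X Y K} → depth B ≤ depth A → 2 ∣ X →
    IsNu2 (a ^ X + b ^ Y) K → K ≢ 1 → K ≡ depth B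
  even-solution {X} {Y} {K} αb≤αa 2∣X νK K≢1 with 2 ∣? Y
  ... | yes 2∣Y = contradiction (IsNu2-unique {j = K} νK
        (same-sign-sum {ε = plus} (a^>0 X) (b^>0 Y)
          (≡[mod2^]-weaken {a ^ X} {plus} (m≤n⇒m≤1+n (deep A)) (even-power A 2∣X))
          (≡[mod2^]-weaken {b ^ Y} {plus} (m≤n⇒m≤1+n (deep B)) (even-power B 2∣Y)))) K≢1
  ... | no 2∤Y = exclude-1 νK K≢1
        (subst (λ n → IsNu2 n 1 ⊎ IsNu2 n (depth B)) (+-comm (b ^ Y) (a ^ X))
          (sum-dichotomy {ε = sign B} {plus} (b^>0 Y) (a^>0 X) (deep B) (odd-power B 2∤Y)
            (≡[mod2^]-weaken {a ^ X} {plus} (s≤s αb≤αa) (even-power A 2∣X))))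

  odd-solution : ∀ {X Y K} → depth A < depth B → ¬ 2 ∣ X →
    IsNu2 (a ^ X + b ^ Y) K → K ≢ 1 → K ≡ depth A
  odd-solution {X} {Y} αa<αb 2∤X νK K≢1 with power-residue B Y
  ... | δ , b^Y≡δ = exclude-1 νK K≢1
        (sum-dichotomy {ε = sign A} {δ} (a^>0 X) (b^>0 Y) (deep A) (odd-power A 2∤X)
          (≡[mod2^]-weaken {b ^ Y} {δ} αa<αb b^Y≡δ))

  two-solutions : ∀ {X Y X′ Y′ K K′} → 2 ∣ X → ¬ 2 ∣ X′ →
    IsNu2 (a ^ X + b ^ Y) K → IsNu2 (a ^ X′ + b ^ Y′) K′ → K ≢ 1 → K′ ≢ 1 →
    K ≡ depth A ⊓ depth B ⊎ K′ ≡ depth A ⊓ depth B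
  two-solutions {X} {Y} {X′} {Y′} 2∣X 2∤X′ νK νK′ K≢1 K′≢1 with depth B ≤? depth A
  ... | yes αb≤αa =
    inj₁ (trans (even-solution {X} {Y} αb≤αa 2∣X νK K≢1) (sym (m≥n⇒m⊓n≡n αb≤αa)))
  ... | no  αb≰αa =
    inj₂ (trans (odd-solution {X′} {Y′} αa<αb 2∤X′ νK′ K′≢1)
                (sym (m≤n⇒m⊓n≡m (<⇒≤ αa<αb))))
    where αa<αb = ≰⇒> αb≰αa

lemma4p3 : (a b c : ℕ) → 1 < a → 1 < b → 1 < c →
  Coprime a b → Coprime b c → Coprime a c →
  ¬ (2 ∣ a) → ¬ (2 ∣ b) → 2 ∣ c →
  (νa νb β : ℕ) → IsNu2 (a ^ 2 ∸ 1) νa → IsNu2 (b ^ 2 ∸ 1) νb → IsNu2 c β →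
  (X Y Z X′ Y′ Z′ : ℕ) →
  0 < X → 0 < Y → 0 < Z → 0 < X′ → 0 < Y′ → 0 < Z′ →
  a ^ X + b ^ Y ≡ c ^ Z → a ^ X′ + b ^ Y′ ≡ c ^ Z′ →
  β * Z ≢ 1 → β * Z′ ≢ 1 →
  ¬ (2 ∣ (X + X′)) →
  (β * Z ≡ (νa ∸ 1) ⊓ (νb ∸ 1)) ⊎ (β * Z′ ≡ (νa ∸ 1) ⊓ (νb ∸ 1))
lemma4p3 a b c 1<a 1<b _ _ _ _ 2∤a 2∤b _ νa νb β νa² νb² νc X Y Z X′ Y′ Z′ _ _ _ _ _ _
         eq eq′ βZ≢1 βZ′≢1 2∤X+X′ =
  subst (λ m → β * Z ≡ m ⊎ β * Z′ ≡ m)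
    (cong₂ _⊓_ (depth≡ν∸1 A {νa} νa²) (depth≡ν∸1 B {νb} νb²))
    ([ (λ (2∣X , 2∤X′) →
          two-solutions A B {X} {Y} {X′} {Y′} 2∣X 2∤X′ ν ν′ βZ≢1 βZ′≢1)
     , (λ (2∤X , 2∣X′) →
          swap (two-solutions A B {X′} {Y′} {X} {Y} 2∣X′ 2∤X ν′ ν βZ′≢1 βZ≢1))
     ]′ (2∤m+n⇒parities-differ {X} {X′} 2∤X+X′))
  where
  A = odd2Adic 1<a 2∤a
  B = odd2Adic 1<b 2∤b
  ν : IsNu2 (a ^ X + b ^ Y) (β * Z)
  ν = subst (λ n → IsNu2 n (β * Z)) (sym eq) (IsNu2-^ {k = β} νc Z)
  ν′ : IsNu2 (a ^ X′ + b ^ Y′) (β * Z′)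
  ν′ = subst (λ n → IsNu2 n (β * Z′)) (sym eq′) (IsNu2-^ {k = β} νc Z′)
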